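{- For any $\sigma\in\Pi_n$, $\mathrm{maj}(\sigma)=N_1(\sigma)+N_2(\sigma)$, where $N_1(\sigma)$ is the number of copies of the generalized pattern $\overset{\frown}{1}3|\overset{\frown}{2}$, namely triples $(a,b,c)$ with $a<c<b$, $a,b$ in the same block $B$ of $\sigma$ with $a=\min B$, and $c=\min C$ for a block $C\ne B$ adjacent to $B$; and $N_2(\sigma)$ is the number of copies of $\overset{\frown}{1}/\overset{\frown}{2}4|\overset{\frown}{3}$, namely quadruples $(d,a,c,b)$ with $d<a<c<b$ such that $d=\min D$, $a=\min B$ with $b\in B$, and $c=\min C$, for three pairwise distinct blocks $D,B,C$ of $\sigma$ with $B$ and $C$ adjacent.
   Context: $\Pi_n$ is the set of set partitions of $[n]=\{1,\dots,n\}$, written $\sigma=B_1/B_2/\cdots/B_k$ with blocks in canonical order $\min B_1<\cdots<\min B_k$; blocks $B_i$ and $B_{i+1}$ are adjacent. A descent of $\sigma$ is a pair $(b,B_{i+1})$ with $b\in B_i$ and $b>\min B_{i+1}$. Let $d_i$ be the number of descents $(b,B_{i+1})$ with $b\in B_i$. The major index is $\mathrm{maj}(\sigma)=\sum_{i=1}^{k-1} i\,d_i$. -}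

module Defs where

open import Data.Nat using (ℕ; zero; suc; _+_; _*_; _∸_; _≤_; _<_; _≡ᵇ_; _<ᵇ_; _≤ᵇ_)
open import Data.Fin using (Fin; toℕ)
open import Data.Bool using (Bool; true; false; _∧_; _∨_; not; if_then_else_)
open import Data.List using (List; map; upTo; allFin)
open import Data.Nat.ListAction using (sum)
open import Data.Bool.ListAction using (all; any)
open import Data.Product using (∃)
open import Relation.Binary.PropositionalEquality using (_≡_)

-- Elements of [n] = {1,…,n} are represented by Fin n = {0,…,n-1}
-- (shift by one; order is preserved).
-- Blocks are labelled by Fin k; label 0,1,…,k-1 stands for B_1,…,B_k.

IsMinOf : ∀ {n k} → (Fin n → Fin k) → Fin n → Set
IsMinOf {n} blk x = ∀ (y : Fin n) → blk y ≡ blk x → toℕ x ≤ toℕ y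

record SetPartition (n : ℕ) : Set where
  field
    k          : ℕ
    blk        : Fin n → Fin k
    nonempty   : ∀ (j : Fin k) → ∃ λ (x : Fin n) → blk x ≡ j
    canonical  : ∀ (x y : Fin n) → IsMinOf blk x → IsMinOf blk y →
                 toℕ (blk x) < toℕ (blk y) → toℕ x < toℕ y

module _ {n : ℕ} (σ : SetPartition n) where
  open SetPartition σ

  private
    elems : List (Fin n)
    elems = allFin n

    b# : Fin n → ℕ
    b# x = toℕ (blk x)

    ind : Bool → ℕ
    ind b = if b then 1 else 0

    count : (Fin n → Bool) → ℕ
    count p = sum (map (λ x → ind (p x)) elems)

  sameBlock : Fin n → Fin n → Bool
  sameBlock x y = b# x ≡ᵇ b# y

  isMin : Fin n → Bool
  isMin x = all (λ y → not (sameBlock y x) ∨ (toℕ x ≤ᵇ toℕ y)) elems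

  adjacent : Fin n → Fin n → Bool
  adjacent x y = (suc (b# x) ≡ᵇ b# y) ∨ (suc (b# y) ≡ᵇ b# x)

  -- d i (0-based i) = number of descents (b, B_{i+2}) with b ∈ B_{i+1},
  -- i.e. b ∈ block i and b > min of block i+1.
  des : ℕ → ℕ
  des i = count (λ b → (b# b ≡ᵇ i) ∧
                   any (λ c → isMin c ∧ (b# c ≡ᵇ suc i) ∧ (toℕ c <ᵇ toℕ b)) elems)

  maj : ℕ
  maj = sum (map (λ i → suc i * des i) (upTo (k ∸ 1)))

  N₁ : ℕ
  N₁ = sum (map (λ a → sum (map (λ b → count (λ c →
         (toℕ a <ᵇ toℕ c) ∧ (toℕ c <ᵇ toℕ b) ∧ sameBlock a b ∧ isMin a ∧
         isMin c ∧ not (sameBlock c a) ∧ adjacent a c)) elems)) elems)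

  N₂ : ℕ
  N₂ = sum (map (λ d → sum (map (λ a → sum (map (λ c → count (λ b →
         (toℕ d <ᵇ toℕ a) ∧ (toℕ a <ᵇ toℕ c) ∧ (toℕ c <ᵇ toℕ b) ∧
         isMin d ∧ isMin a ∧ sameBlock a b ∧ isMin c ∧
         not (sameBlock d a) ∧ not (sameBlock d c) ∧ not (sameBlock a c) ∧
         adjacent a c)) elems)) elems)) elems)

{-# OPTIONS --safe #-}
-- Everything is counted by the element b. Call b ∈ B_i a descent top when b > min B_{i+1};
-- maj counts each descent top with weight i. In a copy (a, b, c) of the first pattern,
-- a = min B is determined by b, and c > a forces the adjacent block C to be the one after B,
-- so c = min B_{i+1}: N₁ counts the descent tops. A copy (d, a, c, b) of the second pattern is
-- such a triple together with the minimum d < a of another block; by the canonical order these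
-- are the minima of B_1, …, B_{i-1}, so N₂ counts each descent top with weight i - 1.
module Submission where

open import Defs
open import Data.Bool using (Bool; true; false; _∧_; not; if_then_else_; T)
open import Data.Bool.ListAction using (all; any)
open import Data.Bool.Properties using (∧-zeroʳ; T-∧)
open import Data.Fin using (Fin; toℕ; fromℕ<; punchIn; _≟_) renaming (zero to fzero; suc to fsuc)
open import Data.Fin.Properties using (toℕ-injective; toℕ<n; toℕ-fromℕ<; punchInᵢ≢i)
open import Data.List as List using (tabulate; applyUpTo; allFin)
open import Data.List.Membership.Propositional using (lose)
open import Data.List.Membership.Propositional.Properties using (∈-allFin)
import Data.List.Relation.Unary.All as All
open import Data.List.Relation.Unary.All.Properties using (all⁺; all⁻)
open import Data.List.Relation.Unary.Any using (satisfied)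
open import Data.List.Relation.Unary.Any.Properties using (any⁺; any⁻)
open import Data.Nat using (ℕ; zero; suc; _+_; _*_; _∸_; _≤_; _<_; _≡ᵇ_; _<ᵇ_; z≤n; s≤s)
import Data.Nat.ListAction as ListAction
open import Data.Nat.Properties hiding (_≟_)
open import Algebra.Properties.Semiring.Sum +-*-semiring
  using (sum; sum-syntax; sum-cong-≗; sum-replicate-zero; sum-remove; ∑-comm; ∑-distrib-+;
         *-distribˡ-sum; *-distribʳ-sum)
open import Data.Product using (∃; _×_; _,_; proj₁; proj₂)
open import Data.Sum using (_⊎_; inj₁; inj₂)
open import Data.Unit using (tt)
open import Function using (_∘_; flip)
open import Function.Bundles using (_⇔_; mk⇔; module Equivalence)
open import Relation.Binary.Definitions using (tri<; tri≈; tri>)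
open import Relation.Binary.PropositionalEquality
open import Relation.Nullary using (¬_; yes; no; contradiction)
open import Relation.Nullary.Reflects
open import Relation.Unary using (Pred; Decidable)

open Equivalence using (to; from)
open ≡-Reasoning

𝟙 : Bool → ℕ
𝟙 b = if b then 1 else 0

𝟙-∧ : ∀ x y → 𝟙 (x ∧ y) ≡ 𝟙 x * 𝟙 y
𝟙-∧ false y = refl
𝟙-∧ true  y = sym (*-identityˡ (𝟙 y))

𝟙-true : ∀ {b} → T b → 𝟙 b ≡ 1
𝟙-true {true} _ = refl

𝟙-false : ∀ {b} → ¬ T b → 𝟙 b ≡ 0
𝟙-false {false} _  = refl
𝟙-false {true}  ¬t = contradiction tt ¬t

𝟙-*-implied : ∀ {a b} → (T a → T b) → 𝟙 a * 𝟙 b ≡ 𝟙 a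
𝟙-*-implied {false}         _   = refl
𝟙-*-implied {true} {true}   _   = refl
𝟙-*-implied {true} {false} a⇒b = contradiction tt a⇒b

*-𝟙-cong : ∀ {x y} b → (T b → x ≡ y) → x * 𝟙 b ≡ y * 𝟙 b
*-𝟙-cong {x} {y} false _   = trans (*-zeroʳ x) (sym (*-zeroʳ y))
*-𝟙-cong         true  x≡y = cong (_* 1) (x≡y tt)

𝟙-∧-<ᵇ-suc : ∀ b x j → 𝟙 (b ∧ (x <ᵇ suc j)) ≡ 𝟙 (b ∧ (x <ᵇ j)) + 𝟙 (b ∧ (x ≡ᵇ j))
𝟙-∧-<ᵇ-suc false x       j       = refl
𝟙-∧-<ᵇ-suc true  zero    zero    = refl
𝟙-∧-<ᵇ-suc true  zero    (suc j) = refl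
𝟙-∧-<ᵇ-suc true  (suc x) zero    = refl
𝟙-∧-<ᵇ-suc true  (suc x) (suc j) = 𝟙-∧-<ᵇ-suc true x j

≡ᵇ-reflects-≡ : ∀ m n → Reflects (m ≡ n) (m ≡ᵇ n)
≡ᵇ-reflects-≡ m n = fromEquivalence (≡ᵇ⇒≡ m n) (≡⇒≡ᵇ m n)

reflects⇔ : ∀ {P : Set} {b} → Reflects P b → T b ⇔ P
reflects⇔ (ofʸ p)  = mk⇔ (λ _ → p) (λ _ → tt)
reflects⇔ (ofⁿ ¬p) = mk⇔ (λ ()) ¬p

reflects-≡ : ∀ {P Q : Set} {x y} → Reflects P x → Reflects Q y → P ⇔ Q → x ≡ y
reflects-≡ rP rQ P⇔Q =
  det (fromEquivalence (to P⇔Q ∘ to (reflects⇔ rP)) (from (reflects⇔ rP) ∘ from P⇔Q)) rQ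

module _ {n} {P : Fin n → Set} {p : Fin n → Bool} (reflects : ∀ i → Reflects (P i) (p i)) where

  all-allFin-reflects : Reflects (∀ i → P i) (all p (allFin n))
  all-allFin-reflects = fromEquivalence
    (λ t i → to (reflects⇔ (reflects i)) (All.lookup (all⁺ p (allFin n) t) (∈-allFin i)))
    (λ ∀P → all⁻ p {allFin n} (All.tabulate (λ {i} _ → from (reflects⇔ (reflects i)) (∀P i))))

  any-allFin-reflects : Reflects (∃ P) (any p (allFin n))
  any-allFin-reflects = fromEquivalence
    (λ t → let i , pᵢ = satisfied (any⁻ p (allFin n) t) in i , to (reflects⇔ (reflects i)) pᵢ)
    (λ (i , Pᵢ) → any⁺ p (lose (∈-allFin i) (from (reflects⇔ (reflects i)) Pᵢ)))

𝟙-≡ᵇ-∧ : ∀ (f : ℕ → ℕ) (q : ℕ → Bool) x i →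
         f i * 𝟙 ((x ≡ᵇ i) ∧ q i) ≡ f x * 𝟙 (q x) * 𝟙 (x ≡ᵇ i)
𝟙-≡ᵇ-∧ f q x i with x ≡ᵇ i | ≡ᵇ-reflects-≡ x i
... | true  | ofʸ refl = sym (*-identityʳ _)
... | false | _        = trans (*-zeroʳ (f i)) (sym (*-zeroʳ (f x * 𝟙 (q x))))

least-witness : ∀ {n p} {P : Pred (Fin n) p} → Decidable P →
                ∀ {x} → P x → ∃ λ m → P m × (∀ {y} → P y → toℕ m ≤ toℕ y)
least-witness {suc n} P? {x} Px with P? fzero
... | yes P0 = fzero , P0 , λ _ → z≤n
least-witness {suc n} P? {fzero}  P0 | no ¬P0 = contradiction P0 ¬P0
least-witness {suc n} P? {fsuc x} Px | no ¬P0 =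
  let m , Pm , least = least-witness (P? ∘ fsuc) Px
  in fsuc m , Pm , λ { {fzero} P0 → contradiction P0 ¬P0 ; {fsuc y} Py → s≤s (least Py) }

sum-map-tabulate : ∀ {A : Set} n (f : A → ℕ) (g : Fin n → A) →
                   ListAction.sum (List.map f (tabulate g)) ≡ ∑[ i < n ] f (g i)
sum-map-tabulate zero    f g = refl
sum-map-tabulate (suc n) f g = cong (f (g fzero) +_) (sum-map-tabulate n f (g ∘ fsuc))

sum-map-applyUpTo : ∀ {A : Set} n (f : A → ℕ) (g : ℕ → A) →
                    ListAction.sum (List.map f (applyUpTo g n)) ≡ ∑[ i < n ] f (g (toℕ i))
sum-map-applyUpTo zero    f g = refl
sum-map-applyUpTo (suc n) f g = cong (f (g 0) +_) (sum-map-applyUpTo n f (g ∘ suc))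

sum-map-allFin : ∀ n (f : Fin n → ℕ) → ListAction.sum (List.map f (allFin n)) ≡ ∑[ i < n ] f i
sum-map-allFin n f = sum-map-tabulate n f (λ i → i)

∑-zero : ∀ {n} {t : Fin n → ℕ} → (∀ i → t i ≡ 0) → ∑[ i < n ] t i ≡ 0
∑-zero {n} t≡0 = trans (sum-cong-≗ t≡0) (sum-replicate-zero n)

∑-pointMass : ∀ {n} (t : Fin n → ℕ) i → (∀ j → j ≢ i → t j ≡ 0) → ∑[ j < n ] t j ≡ t i
∑-pointMass {suc n} t i vanishes = begin
  ∑[ j < suc n ] t j               ≡⟨ sum-remove {i = i} t ⟩
  t i + ∑[ j < n ] t (punchIn i j)  ≡⟨ cong (t i +_) (∑-zero (λ j → vanishes _ (punchInᵢ≢i i j))) ⟩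
  t i + 0                          ≡⟨ +-identityʳ (t i) ⟩
  t i                              ∎

∑-𝟙-≡ᵇ : ∀ m x → ∑[ i < m ] 𝟙 (x ≡ᵇ toℕ i) ≡ 𝟙 (x <ᵇ m)
∑-𝟙-≡ᵇ zero    x       = refl
∑-𝟙-≡ᵇ (suc m) zero    = cong suc (sum-replicate-zero m)
∑-𝟙-≡ᵇ (suc m) (suc x) = ∑-𝟙-≡ᵇ m x

module _ {n} (p : Fin n → Bool) (unique : ∀ {i j} → T (p i) → T (p j) → i ≡ j) where

  ∑-𝟙-unique : ∀ {i} → T (p i) → ∑[ j < n ] 𝟙 (p j) ≡ 1
  ∑-𝟙-unique {i} pᵢ =
    trans (∑-pointMass (𝟙 ∘ p) i (λ j j≢i → 𝟙-false (j≢i ∘ flip unique pᵢ))) (𝟙-true pᵢ)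

  ∑-𝟙-any : ∑[ j < n ] 𝟙 (p j) ≡ 𝟙 (any p (allFin n))
  ∑-𝟙-any with any p (allFin n) | any-allFin-reflects (λ i → T-reflects (p i))
  ... | true  | ofʸ (i , pᵢ) = ∑-𝟙-unique pᵢ
  ... | false | ofⁿ none     = ∑-zero (λ j → 𝟙-false (none ∘ (j ,_)))

module _ {n} (σ : SetPartition n) where
  open SetPartition σ

  index : Fin n → ℕ
  index x = toℕ (blk x)

  IsMin : Fin n → Set
  IsMin = IsMinOf blk

  sameBlock-reflects : ∀ x y → Reflects (blk x ≡ blk y) (sameBlock σ x y)
  sameBlock-reflects x y =
    fromEquivalence (toℕ-injective ∘ ≡ᵇ⇒≡ (index x) (index y)) (≡⇒≡ᵇ (index x) (index y) ∘ cong toℕ)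

  isMin-reflects : ∀ x → Reflects (IsMin x) (isMin σ x)
  isMin-reflects x =
    all-allFin-reflects (λ y → sameBlock-reflects y x →-reflects ≤ᵇ-reflects-≤ (toℕ x) (toℕ y))

  adjacent-reflects : ∀ x y →
    Reflects (suc (index x) ≡ index y ⊎ suc (index y) ≡ index x) (adjacent σ x y)
  adjacent-reflects x y = ≡ᵇ-reflects-≡ _ _ ⊎-reflects ≡ᵇ-reflects-≡ _ _

  minimum-unique : ∀ {x y} → IsMin x → IsMin y → index x ≡ index y → x ≡ y
  minimum-unique {x} {y} min-x min-y ix≡iy =
    toℕ-injective (≤-antisym (min-x y (sym x~y)) (min-y x x~y))
    where x~y = toℕ-injective ix≡iy

  minimumOf : ∀ {x} j → blk x ≡ j → ∃ λ m → IsMin m × blk m ≡ j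
  minimumOf j x∈j =
    let m , m∈j , least = least-witness (λ y → blk y ≟ j) x∈j
    in m , (λ y y~m → least (trans y~m m∈j)) , m∈j

  below-minimum : ∀ {x m} → toℕ x < toℕ m → IsMin m → ¬ blk x ≡ blk m
  below-minimum x<m min-m x~m = <⇒≱ x<m (min-m _ x~m)

  minima-ordered : ∀ {x y} → IsMin x → IsMin y → toℕ x < toℕ y → index x < index y
  minima-ordered {x} {y} min-x min-y x<y with <-cmp (index x) (index y)
  ... | tri< ix<iy _ _ = ix<iy
  ... | tri≈ _ ix≡iy _ = contradiction (toℕ-injective ix≡iy) (below-minimum x<y min-y)
  ... | tri> _ _ iy<ix = contradiction (canonical y x min-y min-x iy<ix) (<-asym x<y)

  minima-adjacent : ∀ {a c} → IsMin a → IsMin c → toℕ a < toℕ c →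
                    suc (index a) ≡ index c ⊎ suc (index c) ≡ index a → index c ≡ suc (index a)
  minima-adjacent _     _     _   (inj₁ c-next) = sym c-next
  minima-adjacent min-a min-c a<c (inj₂ a-next) =
    contradiction (canonical _ _ min-c min-a (≤-reflexive a-next)) (<-asym a<c)

  isMinOfBlock : ℕ → Fin n → Bool
  isMinOfBlock j m = isMin σ m ∧ (index m ≡ᵇ j)

  isMinBelow : Fin n → Fin n → Bool
  isMinBelow d a = isMin σ d ∧ (toℕ d <ᵇ toℕ a)

  isNextMinBelow : ℕ → Fin n → Fin n → Bool
  isNextMinBelow i b c = isMin σ c ∧ (index c ≡ᵇ suc i) ∧ (toℕ c <ᵇ toℕ b)

  isDescentAt : ℕ → Fin n → Bool
  isDescentAt i b = any (isNextMinBelow i b) (allFin n)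

  isDescent : Fin n → Bool
  isDescent b = isDescentAt (index b) b

  isCopy₁ : Fin n → Fin n → Fin n → Bool
  isCopy₁ a b c = (toℕ a <ᵇ toℕ c) ∧ (toℕ c <ᵇ toℕ b) ∧ sameBlock σ a b ∧ isMin σ a ∧
                  isMin σ c ∧ not (sameBlock σ c a) ∧ adjacent σ a c

  isCopy₂ : Fin n → Fin n → Fin n → Fin n → Bool
  isCopy₂ d a c b = (toℕ d <ᵇ toℕ a) ∧ (toℕ a <ᵇ toℕ c) ∧ (toℕ c <ᵇ toℕ b) ∧
                    isMin σ d ∧ isMin σ a ∧ sameBlock σ a b ∧ isMin σ c ∧
                    not (sameBlock σ d a) ∧ not (sameBlock σ d c) ∧ not (sameBlock σ a c) ∧
                    adjacent σ a c

  isMinOfBlock-reflects : ∀ j m → Reflects (IsMin m × index m ≡ j) (isMinOfBlock j m)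
  isMinOfBlock-reflects j m = isMin-reflects m ×-reflects ≡ᵇ-reflects-≡ _ _

  isNextMinBelow-reflects : ∀ i b c →
    Reflects (IsMin c × index c ≡ suc i × toℕ c < toℕ b) (isNextMinBelow i b c)
  isNextMinBelow-reflects i b c =
    isMin-reflects c ×-reflects ≡ᵇ-reflects-≡ _ _ ×-reflects <ᵇ-reflects-< _ _

  isCopy₁-reflects : ∀ a b c →
    Reflects (toℕ a < toℕ c × toℕ c < toℕ b × blk a ≡ blk b × IsMin a × IsMin c ×
              ¬ blk c ≡ blk a × (suc (index a) ≡ index c ⊎ suc (index c) ≡ index a))
             (isCopy₁ a b c)
  isCopy₁-reflects a b c =
    <ᵇ-reflects-< _ _ ×-reflects <ᵇ-reflects-< _ _ ×-reflects sameBlock-reflects a b ×-reflects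
    isMin-reflects a ×-reflects isMin-reflects c ×-reflects ¬-reflects (sameBlock-reflects c a)
    ×-reflects adjacent-reflects a c

  isCopy₁-factor : ∀ a b c → isCopy₁ a b c ≡ isMinOfBlock (index b) a ∧ isNextMinBelow (index b) b c
  isCopy₁-factor a b c = reflects-≡
    (isCopy₁-reflects a b c)
    (isMinOfBlock-reflects (index b) a ×-reflects isNextMinBelow-reflects (index b) b c)
    (mk⇔ (λ (a<c , c<b , a~b , min-a , min-c , _ , adj) →
            (min-a , cong toℕ a~b) , min-c ,
            trans (minima-adjacent min-a min-c a<c adj) (cong (suc ∘ toℕ) a~b) , c<b)
         (λ ((min-a , ia≡ib) , min-c , c-next , c<b) →
            let c-next-a = trans c-next (cong suc (sym ia≡ib))
            in canonical a c min-a min-c (≤-reflexive (sym c-next-a)) , c<b , toℕ-injective ia≡ib ,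
               min-a , min-c , (λ c~a → 1+n≢n (trans (sym c-next-a) (cong toℕ c~a))) ,
               inj₁ (sym c-next-a)))

  isCopy₂-factor : ∀ d a c b → isCopy₂ d a c b ≡ isMinBelow d a ∧ isCopy₁ a b c
  isCopy₂-factor d a c b = reflects-≡
    (<ᵇ-reflects-< _ _ ×-reflects <ᵇ-reflects-< _ _ ×-reflects <ᵇ-reflects-< _ _ ×-reflects
     isMin-reflects d ×-reflects isMin-reflects a ×-reflects sameBlock-reflects a b ×-reflects
     isMin-reflects c ×-reflects ¬-reflects (sameBlock-reflects d a) ×-reflects
     ¬-reflects (sameBlock-reflects d c) ×-reflects ¬-reflects (sameBlock-reflects a c) ×-reflects
     adjacent-reflects a c)
    ((isMin-reflects d ×-reflects <ᵇ-reflects-< _ _) ×-reflects isCopy₁-reflects a b c)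
    (mk⇔ (λ (d<a , a<c , c<b , min-d , min-a , a~b , min-c , _ , _ , a≁c , adj) →
            (min-d , d<a) , a<c , c<b , a~b , min-a , min-c , a≁c ∘ sym , adj)
         (λ ((min-d , d<a) , a<c , c<b , a~b , min-a , min-c , c≁a , adj) →
            d<a , a<c , c<b , min-d , min-a , a~b , min-c , below-minimum d<a min-a ,
            below-minimum (<-trans d<a a<c) min-c , c≁a ∘ sym , adj))

  ∑-isNextMinBelow : ∀ i b → ∑[ c < n ] 𝟙 (isNextMinBelow i b c) ≡ 𝟙 (isDescentAt i b)
  ∑-isNextMinBelow i b = ∑-𝟙-any (isNextMinBelow i b) λ {c} {c′} t t′ →
    let min-c  , c-next  , _ = to (reflects⇔ (isNextMinBelow-reflects i b c))  t
        min-c′ , c′-next , _ = to (reflects⇔ (isNextMinBelow-reflects i b c′)) t′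
    in minimum-unique min-c min-c′ (trans c-next (sym c′-next))

  isDescent⇒index< : ∀ {b} → T (isDescent b) → index b < k ∸ 1
  isDescent⇒index< {b} t =
    let c , _ , c-next , _ =
          to (reflects⇔ (any-allFin-reflects (isNextMinBelow-reflects (index b) b))) t
    in ∸-monoˡ-< (subst (_< k) c-next (toℕ<n (blk c))) (s≤s z≤n)

  ∑-isMinOfBlock : ∀ {j} → j < k → ∑[ m < n ] 𝟙 (isMinOfBlock j m) ≡ 1
  ∑-isMinOfBlock {j} j<k = ∑-𝟙-unique (isMinOfBlock j) unique (proj₂ minimum-of-j)
    where
    unique : ∀ {m m′} → T (isMinOfBlock j m) → T (isMinOfBlock j m′) → m ≡ m′
    unique {m} {m′} t t′ =
      let min-m  , m∈j  = to (reflects⇔ (isMinOfBlock-reflects j m))  t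
          min-m′ , m′∈j = to (reflects⇔ (isMinOfBlock-reflects j m′)) t′
      in minimum-unique min-m min-m′ (trans m∈j (sym m′∈j))
    minimum-of-j : ∃ λ m → T (isMinOfBlock j m)
    minimum-of-j =
      let m , min-m , m∈j = minimumOf (fromℕ< j<k) (proj₂ (nonempty (fromℕ< j<k)))
      in m , from (reflects⇔ (isMinOfBlock-reflects j m))
                  (min-m , trans (cong toℕ m∈j) (toℕ-fromℕ< j<k))

  ∑-isMinOfBlock-∧ : ∀ b q → ∑[ a < n ] 𝟙 (isMinOfBlock (index b) a ∧ q) ≡ 𝟙 q
  ∑-isMinOfBlock-∧ b q = begin
    ∑[ a < n ] 𝟙 (isMinOfBlock (index b) a ∧ q)
      ≡⟨ sum-cong-≗ (λ a → 𝟙-∧ (isMinOfBlock (index b) a) q) ⟩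
    ∑[ a < n ] (𝟙 (isMinOfBlock (index b) a) * 𝟙 q)
      ≡⟨ *-distribʳ-sum (𝟙 q) (λ a → 𝟙 (isMinOfBlock (index b) a)) ⟨
    (∑[ a < n ] 𝟙 (isMinOfBlock (index b) a)) * 𝟙 q
      ≡⟨ cong (_* 𝟙 q) (∑-isMinOfBlock (toℕ<n (blk b))) ⟩
    1 * 𝟙 q
      ≡⟨ *-identityˡ (𝟙 q) ⟩
    𝟙 q ∎

  ∑-isMin∧index< : ∀ j → j ≤ k → ∑[ d < n ] 𝟙 (isMin σ d ∧ (index d <ᵇ j)) ≡ j
  ∑-isMin∧index< zero    _   = ∑-zero (λ d → cong 𝟙 (∧-zeroʳ (isMin σ d)))
  ∑-isMin∧index< (suc j) j<k = begin
    ∑[ d < n ] 𝟙 (isMin σ d ∧ (index d <ᵇ suc j))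
      ≡⟨ sum-cong-≗ (λ d → 𝟙-∧-<ᵇ-suc (isMin σ d) (index d) j) ⟩
    ∑[ d < n ] (𝟙 (isMin σ d ∧ (index d <ᵇ j)) + 𝟙 (isMinOfBlock j d))
      ≡⟨ ∑-distrib-+ (λ d → 𝟙 (isMin σ d ∧ (index d <ᵇ j))) (λ d → 𝟙 (isMinOfBlock j d)) ⟩
    ∑[ d < n ] 𝟙 (isMin σ d ∧ (index d <ᵇ j)) + ∑[ d < n ] 𝟙 (isMinOfBlock j d)
      ≡⟨ cong₂ _+_ (∑-isMin∧index< j (<⇒≤ j<k)) (∑-isMinOfBlock j<k) ⟩
    j + 1
      ≡⟨ +-comm j 1 ⟩
    suc j ∎

  ∑-isMinBelow : ∀ {a} → IsMin a → ∑[ d < n ] 𝟙 (isMinBelow d a) ≡ index a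
  ∑-isMinBelow {a} min-a = trans (sum-cong-≗ (λ d → cong 𝟙 (below-a⇔lower-index d)))
                                 (∑-isMin∧index< (index a) (<⇒≤ (toℕ<n (blk a))))
    where
    below-a⇔lower-index : ∀ d → isMinBelow d a ≡ isMin σ d ∧ (index d <ᵇ index a)
    below-a⇔lower-index d = reflects-≡
      (isMin-reflects d ×-reflects <ᵇ-reflects-< _ _)
      (isMin-reflects d ×-reflects <ᵇ-reflects-< _ _)
      (mk⇔ (λ (min-d , d<a) → min-d , minima-ordered min-d min-a d<a)
           (λ (min-d , id<ia) → min-d , canonical d a min-d min-a id<ia))

  ∑-isCopy₁ : ∀ a b → ∑[ c < n ] 𝟙 (isCopy₁ a b c) ≡ 𝟙 (isMinOfBlock (index b) a ∧ isDescent b)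
  ∑-isCopy₁ a b = begin
    ∑[ c < n ] 𝟙 (isCopy₁ a b c)
      ≡⟨ sum-cong-≗ (λ c → trans (cong 𝟙 (isCopy₁-factor a b c))
                                 (𝟙-∧ (isMinOfBlock (index b) a) _)) ⟩
    ∑[ c < n ] (𝟙 (isMinOfBlock (index b) a) * 𝟙 (isNextMinBelow (index b) b c))
      ≡⟨ *-distribˡ-sum (𝟙 (isMinOfBlock (index b) a)) (λ c → 𝟙 (isNextMinBelow (index b) b c)) ⟨
    𝟙 (isMinOfBlock (index b) a) * ∑[ c < n ] 𝟙 (isNextMinBelow (index b) b c)
      ≡⟨ cong (𝟙 (isMinOfBlock (index b) a) *_) (∑-isNextMinBelow (index b) b) ⟩
    𝟙 (isMinOfBlock (index b) a) * 𝟙 (isDescent b)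
      ≡⟨ 𝟙-∧ (isMinOfBlock (index b) a) (isDescent b) ⟨
    𝟙 (isMinOfBlock (index b) a ∧ isDescent b) ∎

  ∑∑-isCopy₂ : ∀ a b →
    ∑[ d < n ] ∑[ c < n ] 𝟙 (isCopy₂ d a c b) ≡ index b * 𝟙 (isMinOfBlock (index b) a ∧ isDescent b)
  ∑∑-isCopy₂ a b = begin
    ∑[ d < n ] ∑[ c < n ] 𝟙 (isCopy₂ d a c b)
      ≡⟨ sum-cong-≗ (λ d → sum-cong-≗ (λ c → trans (cong 𝟙 (isCopy₂-factor d a c b))
                                                  (𝟙-∧ (isMinBelow d a) _))) ⟩
    ∑[ d < n ] ∑[ c < n ] (𝟙 (isMinBelow d a) * 𝟙 (isCopy₁ a b c))
      ≡⟨ sum-cong-≗ (λ d → *-distribˡ-sum (𝟙 (isMinBelow d a)) (λ c → 𝟙 (isCopy₁ a b c))) ⟨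
    ∑[ d < n ] (𝟙 (isMinBelow d a) * ∑[ c < n ] 𝟙 (isCopy₁ a b c))
      ≡⟨ *-distribʳ-sum (∑[ c < n ] 𝟙 (isCopy₁ a b c)) (λ d → 𝟙 (isMinBelow d a)) ⟨
    (∑[ d < n ] 𝟙 (isMinBelow d a)) * ∑[ c < n ] 𝟙 (isCopy₁ a b c)
      ≡⟨ cong (∑[ d < n ] 𝟙 (isMinBelow d a) *_) (∑-isCopy₁ a b) ⟩
    (∑[ d < n ] 𝟙 (isMinBelow d a)) * 𝟙 (isMinOfBlock (index b) a ∧ isDescent b)
      ≡⟨ *-𝟙-cong (isMinOfBlock (index b) a ∧ isDescent b) minima-below-a ⟩
    index b * 𝟙 (isMinOfBlock (index b) a ∧ isDescent b) ∎
    where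
    minima-below-a : T (isMinOfBlock (index b) a ∧ isDescent b) →
                     ∑[ d < n ] 𝟙 (isMinBelow d a) ≡ index b
    minima-below-a t =
      let min-a , a∈b = to (reflects⇔ (isMinOfBlock-reflects (index b) a)) (proj₁ (to T-∧ t))
      in trans (∑-isMinBelow min-a) a∈b

  ∑-isDescentAt-weighted : ∀ b →
    ∑[ i < k ∸ 1 ] (suc (toℕ i) * 𝟙 ((index b ≡ᵇ toℕ i) ∧ isDescentAt (toℕ i) b))
      ≡ suc (index b) * 𝟙 (isDescent b)
  ∑-isDescentAt-weighted b = begin
    ∑[ i < k ∸ 1 ] (suc (toℕ i) * 𝟙 ((index b ≡ᵇ toℕ i) ∧ isDescentAt (toℕ i) b))
      ≡⟨ sum-cong-≗ {k ∸ 1} (λ i → 𝟙-≡ᵇ-∧ suc (λ j → isDescentAt j b) (index b) (toℕ i)) ⟩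
    ∑[ i < k ∸ 1 ] (weight * 𝟙 (index b ≡ᵇ toℕ i))
      ≡⟨ *-distribˡ-sum {k ∸ 1} weight (λ i → 𝟙 (index b ≡ᵇ toℕ i)) ⟨
    weight * ∑[ i < k ∸ 1 ] 𝟙 (index b ≡ᵇ toℕ i)
      ≡⟨ cong (weight *_) (∑-𝟙-≡ᵇ (k ∸ 1) (index b)) ⟩
    weight * 𝟙 (index b <ᵇ k ∸ 1)
      ≡⟨ *-assoc (suc (index b)) (𝟙 (isDescent b)) _ ⟩
    suc (index b) * (𝟙 (isDescent b) * 𝟙 (index b <ᵇ k ∸ 1))
      ≡⟨ cong (suc (index b) *_) (𝟙-*-implied (<⇒<ᵇ ∘ isDescent⇒index<)) ⟩
    weight ∎
    where
    weight : ℕ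
    weight = suc (index b) * 𝟙 (isDescent b)

  maj-by-element : maj σ ≡ ∑[ b < n ] (suc (index b) * 𝟙 (isDescent b))
  maj-by-element = begin
    maj σ
      ≡⟨ sum-map-applyUpTo (k ∸ 1) (λ i → suc i * des σ i) (λ i → i) ⟩
    ∑[ i < k ∸ 1 ] (suc (toℕ i) * des σ (toℕ i))
      ≡⟨ sum-cong-≗ (λ i → cong (suc (toℕ i) *_) (sum-map-allFin n (term i))) ⟩
    ∑[ i < k ∸ 1 ] (suc (toℕ i) * ∑[ b < n ] term i b)
      ≡⟨ sum-cong-≗ (λ i → *-distribˡ-sum (suc (toℕ i)) (term i)) ⟩
    ∑[ i < k ∸ 1 ] ∑[ b < n ] (suc (toℕ i) * term i b)
      ≡⟨ ∑-comm (λ i b → suc (toℕ i) * term i b) ⟩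
    ∑[ b < n ] ∑[ i < k ∸ 1 ] (suc (toℕ i) * term i b)
      ≡⟨ sum-cong-≗ ∑-isDescentAt-weighted ⟩
    ∑[ b < n ] (suc (index b) * 𝟙 (isDescent b)) ∎
    where
    term : Fin (k ∸ 1) → Fin n → ℕ
    term i b = 𝟙 ((index b ≡ᵇ toℕ i) ∧ isDescentAt (toℕ i) b)

  N₁-by-element : N₁ σ ≡ ∑[ b < n ] 𝟙 (isDescent b)
  N₁-by-element = begin
    N₁ σ
      ≡⟨ trans (sum-map-allFin n _) (sum-cong-≗ {n} λ a → trans (sum-map-allFin n _)
           (sum-cong-≗ {n} λ b → sum-map-allFin n (λ c → 𝟙 (isCopy₁ a b c)))) ⟩
    ∑[ a < n ] ∑[ b < n ] ∑[ c < n ] 𝟙 (isCopy₁ a b c)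
      ≡⟨ sum-cong-≗ (λ a → sum-cong-≗ (∑-isCopy₁ a)) ⟩
    ∑[ a < n ] ∑[ b < n ] 𝟙 (isMinOfBlock (index b) a ∧ isDescent b)
      ≡⟨ ∑-comm (λ a b → 𝟙 (isMinOfBlock (index b) a ∧ isDescent b)) ⟩
    ∑[ b < n ] ∑[ a < n ] 𝟙 (isMinOfBlock (index b) a ∧ isDescent b)
      ≡⟨ sum-cong-≗ (λ b → ∑-isMinOfBlock-∧ b (isDescent b)) ⟩
    ∑[ b < n ] 𝟙 (isDescent b) ∎

  N₂-by-element : N₂ σ ≡ ∑[ b < n ] (index b * 𝟙 (isDescent b))
  N₂-by-element = begin
    N₂ σ
      ≡⟨ trans (sum-map-allFin n _) (sum-cong-≗ {n} λ d → trans (sum-map-allFin n _)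
           (sum-cong-≗ {n} λ a → trans (sum-map-allFin n _)
           (sum-cong-≗ {n} λ c → sum-map-allFin n (λ b → 𝟙 (isCopy₂ d a c b))))) ⟩
    ∑[ d < n ] ∑[ a < n ] ∑[ c < n ] ∑[ b < n ] 𝟙 (isCopy₂ d a c b)
      ≡⟨ ∑-comm (λ d a → ∑[ c < n ] ∑[ b < n ] 𝟙 (isCopy₂ d a c b)) ⟩
    ∑[ a < n ] ∑[ d < n ] ∑[ c < n ] ∑[ b < n ] 𝟙 (isCopy₂ d a c b)
      ≡⟨ sum-cong-≗ (λ a → sum-cong-≗ (λ d → ∑-comm (λ c b → 𝟙 (isCopy₂ d a c b)))) ⟩
    ∑[ a < n ] ∑[ d < n ] ∑[ b < n ] ∑[ c < n ] 𝟙 (isCopy₂ d a c b)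
      ≡⟨ sum-cong-≗ (λ a → ∑-comm (λ d b → ∑[ c < n ] 𝟙 (isCopy₂ d a c b))) ⟩
    ∑[ a < n ] ∑[ b < n ] ∑[ d < n ] ∑[ c < n ] 𝟙 (isCopy₂ d a c b)
      ≡⟨ sum-cong-≗ (λ a → sum-cong-≗ (∑∑-isCopy₂ a)) ⟩
    ∑[ a < n ] ∑[ b < n ] (index b * 𝟙 (isMinOfBlock (index b) a ∧ isDescent b))
      ≡⟨ ∑-comm (λ a b → index b * 𝟙 (isMinOfBlock (index b) a ∧ isDescent b)) ⟩
    ∑[ b < n ] ∑[ a < n ] (index b * 𝟙 (isMinOfBlock (index b) a ∧ isDescent b))
      ≡⟨ sum-cong-≗ (λ b → *-distribˡ-sum (index b)
                                            (λ a → 𝟙 (isMinOfBlock (index b) a ∧ isDescent b))) ⟨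
    ∑[ b < n ] (index b * ∑[ a < n ] 𝟙 (isMinOfBlock (index b) a ∧ isDescent b))
      ≡⟨ sum-cong-≗ (λ b → cong (index b *_) (∑-isMinOfBlock-∧ b (isDescent b))) ⟩
    ∑[ b < n ] (index b * 𝟙 (isDescent b)) ∎

proposition6p2 : (n : ℕ) (σ : SetPartition n) → maj σ ≡ N₁ σ + N₂ σ
proposition6p2 n σ = begin
  maj σ
    ≡⟨ maj-by-element σ ⟩
  ∑[ b < n ] (suc (index σ b) * 𝟙 (isDescent σ b))
    ≡⟨ ∑-distrib-+ (λ b → 𝟙 (isDescent σ b)) (λ b → index σ b * 𝟙 (isDescent σ b)) ⟩
  ∑[ b < n ] 𝟙 (isDescent σ b) + ∑[ b < n ] (index σ b * 𝟙 (isDescent σ b))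
    ≡⟨ cong₂ _+_ (N₁-by-element σ) (N₂-by-element σ) ⟨
  N₁ σ + N₂ σ ∎
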